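{- Let $n_1,m_1,m_2,n_2$ be positive integers and let $\Omega$ be the graph whose vertex set is the disjoint union of sets $B_1,A_1,A_2,B_2$ with $|B_i|=n_i$, $|A_i|=m_i$, where $B_1,B_2$ are cliques, $A_1,A_2$ are independent sets, consecutive sets in the order $B_1,A_1,A_2,B_2$ are completely joined, and there are no other edges. If $H$ is a connected induced subgraph of $\Omega$, then $H\in\Lambda_2^{\mathbb Z}$.
   Context: All graphs are finite, simple, connected. For a connected graph $G$ with vertex set $V$, let $X=\{x_u:u\in V\}$ be indeterminates, $D(G)$ the distance matrix (entries $d_G(u,v)$), and $D_X(G)=\operatorname{diag}(X)+D(G)$. For a commutative ring $\mathfrak R$ with unity, the $i$-th distance ideal $I_i^{\mathfrak R}(G)$ is the ideal of $\mathfrak R[X]$ generated by all $i\times i$ minors of $D_X(G)$; an ideal is trivial if it equals $\mathfrak R[X]$; $\Lambda_k^{\mathfrak R}$ is the family of connected graphs with at most $k$ trivial distance ideals over $\mathfrak R[X]$. -}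

module Defs where

open import Data.Nat as ℕ using (ℕ; zero; suc; _≤_)
open import Data.Integer as ℤ using (ℤ; +_)
open import Data.Fin as Fin using (Fin; punchIn)
open import Data.Fin.Properties using (_≟_)
open import Data.Sum using (_⊎_; inj₁; inj₂)
open import Data.Product using (Σ; ∃; _×_; _,_)
open import Data.List using (List; []; _∷_)
open import Data.Unit using (⊤)
open import Data.Empty using (⊥)
open import Data.Bool using (if_then_else_)
open import Relation.Nullary using (¬_)
open import Relation.Nullary.Decidable using (⌊_⌋)
open import Relation.Binary.PropositionalEquality using (_≡_; _≢_)

VΩ : ℕ → ℕ → ℕ → ℕ → Set
VΩ n₁ m₁ m₂ n₂ = Fin n₁ ⊎ (Fin m₁ ⊎ (Fin m₂ ⊎ Fin n₂))

AdjΩ : ∀ {n₁ m₁ m₂ n₂} → VΩ n₁ m₁ m₂ n₂ → VΩ n₁ m₁ m₂ n₂ → Set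
AdjΩ (inj₁ i) (inj₁ j) = i ≢ j
AdjΩ (inj₁ _) (inj₂ (inj₁ _)) = ⊤
AdjΩ (inj₂ (inj₁ _)) (inj₁ _) = ⊤
AdjΩ (inj₂ (inj₁ _)) (inj₂ (inj₂ (inj₁ _))) = ⊤
AdjΩ (inj₂ (inj₂ (inj₁ _))) (inj₂ (inj₁ _)) = ⊤
AdjΩ (inj₂ (inj₂ (inj₁ _))) (inj₂ (inj₂ (inj₂ _))) = ⊤
AdjΩ (inj₂ (inj₂ (inj₂ _))) (inj₂ (inj₂ (inj₁ _))) = ⊤
AdjΩ (inj₂ (inj₂ (inj₂ i))) (inj₂ (inj₂ (inj₂ j))) = i ≢ j
AdjΩ _ _ = ⊥

-- Induced subgraph of Ω on the image of an (injective) map ι : Fin k → VΩ.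
AdjInd : ∀ {n₁ m₁ m₂ n₂ k} → (Fin k → VΩ n₁ m₁ m₂ n₂) → Fin k → Fin k → Set
AdjInd ι u v = AdjΩ (ι u) (ι v)

data Walk {k : ℕ} (E : Fin k → Fin k → Set) : Fin k → Fin k → ℕ → Set where
  here : ∀ {u} → Walk E u u 0
  step : ∀ {u w v ℓ} → E u w → Walk E w v ℓ → Walk E u (v) (suc ℓ)

Connected : ∀ {k} → (Fin k → Fin k → Set) → Set
Connected {k} E = ∀ (u v : Fin k) → ∃ λ ℓ → Walk E u v ℓ

IsDist : ∀ {k} → (Fin k → Fin k → Set) → Fin k → Fin k → ℕ → Set
IsDist E u v d = Walk E u v d × (∀ ℓ → Walk E u v ℓ → d ≤ ℓ)

IsDistanceMatrix : ∀ {k} → (Fin k → Fin k → Set) → (Fin k → Fin k → ℕ) → Set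
IsDistanceMatrix {k} E D = ∀ (u v : Fin k) → IsDist E u v (D u v)

-- The polynomial ring ℤ[x₀,…,x_{k-1}], presented as the free commutative
-- ring over ℤ on the variables: syntax modulo the commutative-ring
-- congruence, with the constants forming a copy of ℤ.

infixl 6 _⊕_
infixl 7 _⊗_

data Poly (k : ℕ) : Set where
  con : ℤ → Poly k
  var : Fin k → Poly k
  _⊕_ : Poly k → Poly k → Poly k
  _⊗_ : Poly k → Poly k → Poly k
  neg : Poly k → Poly k

infix 4 _≈_

data _≈_ {k : ℕ} : Poly k → Poly k → Set where
  ≈-refl  : ∀ {p} → p ≈ p
  ≈-sym   : ∀ {p q} → p ≈ q → q ≈ p
  ≈-trans : ∀ {p q r} → p ≈ q → q ≈ r → p ≈ r
  ⊕-cong  : ∀ {p p′ q q′} → p ≈ p′ → q ≈ q′ → p ⊕ q ≈ p′ ⊕ q′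
  ⊗-cong  : ∀ {p p′ q q′} → p ≈ p′ → q ≈ q′ → p ⊗ q ≈ p′ ⊗ q′
  neg-cong : ∀ {p q} → p ≈ q → neg p ≈ neg q
  ⊕-assoc : ∀ p q r → (p ⊕ q) ⊕ r ≈ p ⊕ (q ⊕ r)
  ⊕-comm  : ∀ p q → p ⊕ q ≈ q ⊕ p
  ⊕-idʳ   : ∀ p → p ⊕ con (+ 0) ≈ p
  ⊕-invʳ  : ∀ p → p ⊕ neg p ≈ con (+ 0)
  ⊗-assoc : ∀ p q r → (p ⊗ q) ⊗ r ≈ p ⊗ (q ⊗ r)
  ⊗-comm  : ∀ p q → p ⊗ q ≈ q ⊗ p
  ⊗-idʳ   : ∀ p → p ⊗ con (+ 1) ≈ p
  distribʳ : ∀ p q r → (p ⊕ q) ⊗ r ≈ (p ⊗ r) ⊕ (q ⊗ r)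
  con-+   : ∀ a b → con a ⊕ con b ≈ con (a ℤ.+ b)
  con-*   : ∀ a b → con a ⊗ con b ≈ con (a ℤ.* b)
  con-neg : ∀ a → neg (con a) ≈ con (ℤ.- a)

sumP : ∀ {k n} → (Fin n → Poly k) → Poly k
sumP {n = zero}  f = con (+ 0)
sumP {n = suc n} f = f Fin.zero ⊕ sumP (λ j → f (Fin.suc j))

sign : ∀ {k} → ℕ → Poly k
sign zero          = con (+ 1)
sign (suc zero)    = con (ℤ.- (+ 1))
sign (suc (suc j)) = sign j

det : ∀ {k n} → (Fin n → Fin n → Poly k) → Poly k
det {n = zero}  M = con (+ 1)
det {n = suc n} M =
  sumP (λ j → sign (Fin.toℕ j) ⊗ M Fin.zero j
              ⊗ det (λ r c → M (Fin.suc r) (punchIn j c)))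

DX : ∀ {k} → (Fin k → Fin k → ℕ) → Fin k → Fin k → Poly k
DX D u v = (if ⌊ u ≟ v ⌋ then var u else con (+ 0)) ⊕ con (+ D u v)

-- Strictly increasing maps Fin i → Fin k (i-subsets of rows/columns).
IncMap : ℕ → ℕ → Set
IncMap i k = Σ (Fin i → Fin k) λ f → ∀ a b → a Fin.< b → f a Fin.< f b

minor : ∀ {i k} → (Fin k → Fin k → Poly k) → IncMap i k → IncMap i k → Poly k
minor M (r , _) (c , _) = det (λ a b → M (r a) (c b))

-- An ideal generated by a family of polynomials is trivial iff it
-- contains 1, i.e. 1 is a finite ℤ[X]-linear combination of generators.
sumList : ∀ {k} → List (Poly k) → Poly k
sumList []       = con (+ 0)
sumList (p ∷ ps) = p ⊕ sumList ps

mapL : ∀ {A B : Set} → (A → B) → List A → List B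
mapL f []       = []
mapL f (x ∷ xs) = f x ∷ mapL f xs

-- The i-th distance ideal I_i(G) (generated by all i×i minors of M=D_X(G))
-- is trivial (= ℤ[X]).
TrivialIdeal : ∀ {k} → (Fin k → Fin k → Poly k) → ℕ → Set
TrivialIdeal {k} M i =
  Σ (List (Poly k × IncMap i k × IncMap i k)) λ L →
    sumList (mapL (λ { (a , r , c) → a ⊗ minor M r c }) L) ≈ con (+ 1)

-- G ∈ Λ_m^ℤ : at most m of the ideals I_1, I_2, … are trivial, i.e.
-- there are no m+1 distinct indices i ≥ 1 with I_i trivial.
InΛ : ℕ → ∀ {k} → (Fin k → Fin k → ℕ) → Set
InΛ m D =
  (f : Fin (suc m) → ℕ) → (∀ a b → a Fin.< b → f a ℕ.< f b) →
  (∀ a → 1 ≤ f a) → ¬ (∀ a → TrivialIdeal (DX D) (f a))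

{-# OPTIONS --safe #-}
module Submission where

open import Defs
open import Data.Nat as ℕ using (ℕ; zero; suc; _≤_; _≤′_; z≤n; s≤s)
import Data.Nat.Properties as ℕP
open import Data.Integer as ℤ using (ℤ; +_)
import Data.Integer.Properties as ℤP
open import Data.Integer.Divisibility.Signed using (_∣_; _∣?_; divides; ∣m∣n⇒∣m+n; ∣n⇒∣m*n)
open import Data.Fin as Fin using (Fin; punchIn; #_)
open import Data.Fin.Properties using (_≟_)
open import Data.Vec.Functional as Vector using ()
open import Data.List using ([]; _∷_)
open import Data.Sum using (inj₁; inj₂)
open import Data.Product using (∃; _,_; proj₁; proj₂)
open import Data.Unit using (tt)
open import Data.Empty using (⊥-elim)
open import Data.Bool using (if_then_else_)
open import Function using (_∘_)
open import Function.Definitions using (Injective)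
open import Relation.Nullary using (¬_; yes; no)
open import Relation.Nullary.Decidable using (Dec; ⌊_⌋; map′; _×-dec_; _→-dec_; from-yes; from-no)
open import Relation.Binary.PropositionalEquality
open import Algebra.Properties.Monoid.Sum ℤP.+-0-monoid using (sum; sum-cong-≗)

-- Put x_u = 1 on B₁ ∪ B₂ and x_u = 2 on A₁ ∪ A₂, i.e. the distance between two
-- distinct vertices of u's part. In a connected induced subgraph H of Ω the distance
-- between distinct vertices depends only on their parts, so the evaluated D_X(H) has
-- entries M(part u, part v) for the 4×4 matrix M with rows (indexed B₁, A₁, A₂, B₂)
--   1 1 2 3 / 1 2 1 2 / 2 1 2 1 / 3 2 1 1.
-- Modulo 3 the rows A₁ and A₂ are B₁ − B₂ and B₂ − B₁, so M has rank 2 over 𝔽₃ and every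
-- minor of size at least 3 of the evaluated matrix is divisible by 3 (checked on 3×3
-- patterns, then propagated by Laplace expansion). Hence the evaluation maps I₃, I₄, …
-- into 3ℤ, they do not contain 1, and at most I₁ and I₂ are trivial.

signℤ : ℕ → ℤ
signℤ zero          = + 1
signℤ (suc zero)    = ℤ.- (+ 1)
signℤ (suc (suc j)) = signℤ j

detℤ : ∀ {n} → (Fin n → Fin n → ℤ) → ℤ
detℤ {zero}  M = + 1
detℤ {suc n} M =
  sum (λ j → signℤ (Fin.toℕ j) ℤ.* M Fin.zero j ℤ.* detℤ (λ r c → M (Fin.suc r) (punchIn j c)))

detℤ-cong : ∀ {n} {M N : Fin n → Fin n → ℤ} → (∀ a b → M a b ≡ N a b) → detℤ M ≡ detℤ N
detℤ-cong {zero}  M≡N = refl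
detℤ-cong {suc n} M≡N = sum-cong-≗ λ j →
  cong₂ (λ x y → signℤ (Fin.toℕ j) ℤ.* x ℤ.* y) (M≡N Fin.zero j)
        (detℤ-cong λ r c → M≡N (Fin.suc r) (punchIn j c))

∣-sum : ∀ {d n} (f : Fin n → ℤ) → (∀ j → d ∣ f j) → d ∣ sum f
∣-sum {n = zero}  f d∣f = divides (+ 0) refl
∣-sum {n = suc n} f d∣f = ∣m∣n⇒∣m+n (d∣f Fin.zero) (∣-sum (f ∘ Fin.suc) (λ j → d∣f (Fin.suc j)))

reindex : ∀ {R C : Set} {n} → (R → C → ℤ) → (Fin n → R) → (Fin n → C) → Fin n → Fin n → ℤ
reindex M α β a b = M (α a) (β b)

∣-det-reindex-suc : ∀ {R C : Set} {d n} (M : R → C → ℤ) →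
                    (∀ α β → d ∣ detℤ {n} (reindex M α β)) →
                    ∀ α β → d ∣ detℤ {suc n} (reindex M α β)
∣-det-reindex-suc M d∣det α β = ∣-sum _ λ j →
  ∣n⇒∣m*n (signℤ (Fin.toℕ j) ℤ.* M (α Fin.zero) (β j)) (d∣det (α ∘ Fin.suc) (β ∘ punchIn j))

∣-det-reindex-≤′ : ∀ {R C : Set} {d n₀ n} (M : R → C → ℤ) → n₀ ≤′ n →
                   (∀ α β → d ∣ detℤ {n₀} (reindex M α β)) →
                   ∀ α β → d ∣ detℤ {n} (reindex M α β)
∣-det-reindex-≤′ M ℕ.≤′-refl        d∣det = d∣det
∣-det-reindex-≤′ M (ℕ.≤′-step n₀≤n) d∣det = ∣-det-reindex-suc M (∣-det-reindex-≤′ M n₀≤n d∣det)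

eval : ∀ {k} → (Fin k → ℤ) → Poly k → ℤ
eval ρ (con a) = a
eval ρ (var u) = ρ u
eval ρ (p ⊕ q) = eval ρ p ℤ.+ eval ρ q
eval ρ (p ⊗ q) = eval ρ p ℤ.* eval ρ q
eval ρ (neg p) = ℤ.- eval ρ p

eval-cong : ∀ {k} (ρ : Fin k → ℤ) {p q : Poly k} → p ≈ q → eval ρ p ≡ eval ρ q
eval-cong ρ ≈-refl             = refl
eval-cong ρ (≈-sym p≈q)        = sym (eval-cong ρ p≈q)
eval-cong ρ (≈-trans p≈q q≈r)  = trans (eval-cong ρ p≈q) (eval-cong ρ q≈r)
eval-cong ρ (⊕-cong p≈p′ q≈q′) = cong₂ ℤ._+_ (eval-cong ρ p≈p′) (eval-cong ρ q≈q′)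
eval-cong ρ (⊗-cong p≈p′ q≈q′) = cong₂ ℤ._*_ (eval-cong ρ p≈p′) (eval-cong ρ q≈q′)
eval-cong ρ (neg-cong p≈q)     = cong ℤ.-_ (eval-cong ρ p≈q)
eval-cong ρ (⊕-assoc p q r)    = ℤP.+-assoc (eval ρ p) (eval ρ q) (eval ρ r)
eval-cong ρ (⊕-comm p q)       = ℤP.+-comm (eval ρ p) (eval ρ q)
eval-cong ρ (⊕-idʳ p)          = ℤP.+-identityʳ (eval ρ p)
eval-cong ρ (⊕-invʳ p)         = ℤP.+-inverseʳ (eval ρ p)
eval-cong ρ (⊗-assoc p q r)    = ℤP.*-assoc (eval ρ p) (eval ρ q) (eval ρ r)
eval-cong ρ (⊗-comm p q)       = ℤP.*-comm (eval ρ p) (eval ρ q)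
eval-cong ρ (⊗-idʳ p)          = ℤP.*-identityʳ (eval ρ p)
eval-cong ρ (distribʳ p q r)   = ℤP.*-distribʳ-+ (eval ρ r) (eval ρ p) (eval ρ q)
eval-cong ρ (con-+ a b)        = refl
eval-cong ρ (con-* a b)        = refl
eval-cong ρ (con-neg a)        = refl

eval-sumP : ∀ {k n} (ρ : Fin k → ℤ) (f : Fin n → Poly k) → eval ρ (sumP f) ≡ sum (eval ρ ∘ f)
eval-sumP {n = zero}  ρ f = refl
eval-sumP {n = suc n} ρ f = cong (λ s → eval ρ (f Fin.zero) ℤ.+ s) (eval-sumP ρ (f ∘ Fin.suc))

eval-sign : ∀ {k} (ρ : Fin k → ℤ) j → eval ρ (sign j) ≡ signℤ j
eval-sign ρ zero          = refl
eval-sign ρ (suc zero)    = refl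
eval-sign ρ (suc (suc j)) = eval-sign ρ j

eval-det : ∀ {k n} (ρ : Fin k → ℤ) (M : Fin n → Fin n → Poly k) →
           eval ρ (det M) ≡ detℤ (λ a b → eval ρ (M a b))
eval-det {n = zero}  ρ M = refl
eval-det {k} {suc n} ρ M = trans (eval-sumP ρ expansion) (sum-cong-≗ λ j →
  cong₂ (λ s x → s ℤ.* eval ρ (M Fin.zero j) ℤ.* x)
        (eval-sign ρ (Fin.toℕ j)) (eval-det ρ (λ r c → M (Fin.suc r) (punchIn j c))))
  where
  expansion : Fin (suc n) → Poly k
  expansion j = sign (Fin.toℕ j) ⊗ M Fin.zero j ⊗ det (λ r c → M (Fin.suc r) (punchIn j c))

minors-divisible⇒¬TrivialIdeal : ∀ {k} (M : Fin k → Fin k → Poly k) (ρ : Fin k → ℤ) {d} i →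
  ¬ d ∣ + 1 → (∀ r c → d ∣ eval ρ (minor M r c)) → ¬ TrivialIdeal M i
minors-divisible⇒¬TrivialIdeal M ρ {d} i d∤1 d∣minor (L , ∑≈1) =
  d∤1 (subst (d ∣_) (eval-cong ρ ∑≈1) (d∣∑ L))
  where
  d∣∑ : ∀ L → d ∣ eval ρ (sumList (mapL (λ { (a , r , c) → a ⊗ minor M r c }) L))
  d∣∑ []                = divides (+ 0) refl
  d∣∑ ((a , r , c) ∷ L) = ∣m∣n⇒∣m+n (∣n⇒∣m*n (eval ρ a) (d∣minor r c)) (d∣∑ L)

data Part : Set where
  B₁ A₁ A₂ B₂ : Part

all-Part? : {P : Part → Set} → (∀ t → Dec (P t)) → Dec (∀ t → P t)
all-Part? P? = map′ (λ { (p , q , r , s) → λ { B₁ → p ; A₁ → q ; A₂ → r ; B₂ → s } })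
                    (λ ∀P → ∀P B₁ , ∀P A₁ , ∀P A₂ , ∀P B₂)
                    (P? B₁ ×-dec P? A₁ ×-dec P? A₂ ×-dec P? B₂)

partDist : Part → Part → ℕ
partDist B₁ B₁ = 1
partDist B₁ A₁ = 1
partDist B₁ A₂ = 2
partDist B₁ B₂ = 3
partDist A₁ B₁ = 1
partDist A₁ A₁ = 2
partDist A₁ A₂ = 1
partDist A₁ B₂ = 2
partDist A₂ B₁ = 2
partDist A₂ A₁ = 1
partDist A₂ A₂ = 2
partDist A₂ B₂ = 1
partDist B₂ B₁ = 3
partDist B₂ A₁ = 2
partDist B₂ A₂ = 1
partDist B₂ B₂ = 1

partMatrix : Part → Part → ℤ
partMatrix t s = + partDist t s

3∣det-partMatrix-3×3 : ∀ α β → + 3 ∣ detℤ {3} (reindex partMatrix α β)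
3∣det-partMatrix-3×3 α β =
  from-yes (all-Part? λ a₀ → all-Part? λ a₁ → all-Part? λ a₂ →
            all-Part? λ b₀ → all-Part? λ b₁ → all-Part? λ b₂ →
            + 3 ∣? detℤ (reindex partMatrix (a₀ Vector.∷ a₁ Vector.∷ a₂ Vector.∷ Vector.[])
                                            (b₀ Vector.∷ b₁ Vector.∷ b₂ Vector.∷ Vector.[])))
    (α Fin.zero) (α (Fin.suc Fin.zero)) (α (Fin.suc (Fin.suc Fin.zero)))
    (β Fin.zero) (β (Fin.suc Fin.zero)) (β (Fin.suc (Fin.suc Fin.zero)))

3∣det-partMatrix : ∀ {n} → 3 ≤ n → ∀ α β → + 3 ∣ detℤ {n} (reindex partMatrix α β)
3∣det-partMatrix 3≤n = ∣-det-reindex-≤′ partMatrix (ℕP.≤⇒≤′ 3≤n) 3∣det-partMatrix-3×3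

position : Part → ℕ
position B₁ = 0
position A₁ = 1
position A₂ = 2
position B₂ = 3

-- The distance in the path B₁ – A₁ – A₂ – B₂; unlike partDist it vanishes on the diagonal.
gap : Part → Part → ℕ
gap t s = ℕ.∣ position t - position s ∣

gap≤partDist : ∀ t s → gap t s ≤ partDist t s
gap≤partDist = from-yes (all-Part? λ t → all-Part? λ s → gap t s ℕ.≤? partDist t s)

partDist-step : ∀ t w v → partDist t w ≡ 1 → partDist t v ≤ suc (gap w v)
partDist-step = from-yes (all-Part? λ t → all-Part? λ w → all-Part? λ v →
                          partDist t w ℕ.≟ 1 →-dec partDist t v ℕ.≤? suc (gap w v))

partDist-sym : ∀ t s → partDist t s ≡ partDist s t
partDist-sym = from-yes (all-Part? λ t → all-Part? λ s → partDist t s ℕ.≟ partDist s t)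

part : ∀ {n₁ m₁ m₂ n₂} → VΩ n₁ m₁ m₂ n₂ → Part
part (inj₁ _)               = B₁
part (inj₂ (inj₁ _))        = A₁
part (inj₂ (inj₂ (inj₁ _))) = A₂
part (inj₂ (inj₂ (inj₂ _))) = B₂

AdjΩ⇒partDist≡1 : ∀ {n₁ m₁ m₂ n₂} (x y : VΩ n₁ m₁ m₂ n₂) →
                  AdjΩ x y → partDist (part x) (part y) ≡ 1
AdjΩ⇒partDist≡1 (inj₁ _)               (inj₁ _)               _ = refl
AdjΩ⇒partDist≡1 (inj₁ _)               (inj₂ (inj₁ _))        _ = refl
AdjΩ⇒partDist≡1 (inj₂ (inj₁ _))        (inj₁ _)               _ = refl
AdjΩ⇒partDist≡1 (inj₂ (inj₁ _))        (inj₂ (inj₂ (inj₁ _))) _ = refl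
AdjΩ⇒partDist≡1 (inj₂ (inj₂ (inj₁ _))) (inj₂ (inj₁ _))        _ = refl
AdjΩ⇒partDist≡1 (inj₂ (inj₂ (inj₁ _))) (inj₂ (inj₂ (inj₂ _))) _ = refl
AdjΩ⇒partDist≡1 (inj₂ (inj₂ (inj₂ _))) (inj₂ (inj₂ (inj₁ _))) _ = refl
AdjΩ⇒partDist≡1 (inj₂ (inj₂ (inj₂ _))) (inj₂ (inj₂ (inj₂ _))) _ = refl
AdjΩ⇒partDist≡1 (inj₁ _)               (inj₂ (inj₂ (inj₁ _))) ()
AdjΩ⇒partDist≡1 (inj₁ _)               (inj₂ (inj₂ (inj₂ _))) ()
AdjΩ⇒partDist≡1 (inj₂ (inj₁ _))        (inj₂ (inj₁ _))        ()
AdjΩ⇒partDist≡1 (inj₂ (inj₁ _))        (inj₂ (inj₂ (inj₂ _))) ()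
AdjΩ⇒partDist≡1 (inj₂ (inj₂ (inj₁ _))) (inj₁ _)               ()
AdjΩ⇒partDist≡1 (inj₂ (inj₂ (inj₁ _))) (inj₂ (inj₂ (inj₁ _))) ()
AdjΩ⇒partDist≡1 (inj₂ (inj₂ (inj₂ _))) (inj₁ _)               ()
AdjΩ⇒partDist≡1 (inj₂ (inj₂ (inj₂ _))) (inj₂ (inj₁ _))        ()

partDist≡1⇒AdjΩ : ∀ {n₁ m₁ m₂ n₂} (x y : VΩ n₁ m₁ m₂ n₂) →
                  x ≢ y → partDist (part x) (part y) ≡ 1 → AdjΩ x y
partDist≡1⇒AdjΩ (inj₁ _)               (inj₁ _)               x≢y _ = x≢y ∘ cong inj₁
partDist≡1⇒AdjΩ (inj₁ _)               (inj₂ (inj₁ _))        _   _ = tt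
partDist≡1⇒AdjΩ (inj₂ (inj₁ _))        (inj₁ _)               _   _ = tt
partDist≡1⇒AdjΩ (inj₂ (inj₁ _))        (inj₂ (inj₂ (inj₁ _))) _   _ = tt
partDist≡1⇒AdjΩ (inj₂ (inj₂ (inj₁ _))) (inj₂ (inj₁ _))        _   _ = tt
partDist≡1⇒AdjΩ (inj₂ (inj₂ (inj₁ _))) (inj₂ (inj₂ (inj₂ _))) _   _ = tt
partDist≡1⇒AdjΩ (inj₂ (inj₂ (inj₂ _))) (inj₂ (inj₂ (inj₁ _))) _   _ = tt
partDist≡1⇒AdjΩ (inj₂ (inj₂ (inj₂ _))) (inj₂ (inj₂ (inj₂ _))) x≢y _ = x≢y ∘ cong (inj₂ ∘ inj₂ ∘ inj₂)
partDist≡1⇒AdjΩ (inj₁ _)               (inj₂ (inj₂ (inj₁ _))) _ ()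
partDist≡1⇒AdjΩ (inj₁ _)               (inj₂ (inj₂ (inj₂ _))) _ ()
partDist≡1⇒AdjΩ (inj₂ (inj₁ _))        (inj₂ (inj₁ _))        _ ()
partDist≡1⇒AdjΩ (inj₂ (inj₁ _))        (inj₂ (inj₂ (inj₂ _))) _ ()
partDist≡1⇒AdjΩ (inj₂ (inj₂ (inj₁ _))) (inj₁ _)               _ ()
partDist≡1⇒AdjΩ (inj₂ (inj₂ (inj₁ _))) (inj₂ (inj₂ (inj₁ _))) _ ()
partDist≡1⇒AdjΩ (inj₂ (inj₂ (inj₂ _))) (inj₁ _)               _ ()
partDist≡1⇒AdjΩ (inj₂ (inj₂ (inj₂ _))) (inj₂ (inj₁ _))        _ ()

module InducedSubgraph {n₁ m₁ m₂ n₂ k} (ι : Fin k → VΩ n₁ m₁ m₂ n₂)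
                       (ι-injective : Injective _≡_ _≡_ ι) where

  partOf : Fin k → Part
  partOf u = part (ι u)

  dist : Fin k → Fin k → ℕ
  dist u v = if ⌊ u ≟ v ⌋ then 0 else partDist (partOf u) (partOf v)

  dist≤partDist : ∀ u v → dist u v ≤ partDist (partOf u) (partOf v)
  dist≤partDist u v with u ≟ v
  ... | yes _ = z≤n
  ... | no  _ = ℕP.≤-refl

  gap≤dist : ∀ u v → gap (partOf u) (partOf v) ≤ dist u v
  gap≤dist u v with u ≟ v
  ... | yes refl = ℕP.≤-reflexive (ℕP.∣n-n∣≡0 (position (partOf u)))
  ... | no  _    = gap≤partDist (partOf u) (partOf v)

  adjacent⇒partDist≡1 : ∀ {u w t s} → partOf u ≡ t → partOf w ≡ s →
                        AdjInd ι u w → partDist t s ≡ 1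
  adjacent⇒partDist≡1 {u} {w} refl refl = AdjΩ⇒partDist≡1 (ι u) (ι w)

  adjacent : ∀ {u w t s} → partOf u ≡ t → partOf w ≡ s → partDist t s ≡ 1 →
             (t ≡ s → u ≢ w) → AdjInd ι u w
  adjacent {u} {w} refl refl t~s u≢w =
    partDist≡1⇒AdjΩ (ι u) (ι w) (λ ιu≡ιw → u≢w (cong part ιu≡ιw) (ι-injective ιu≡ιw)) t~s

  edge : ∀ {u w t s} → partOf u ≡ t → partOf w ≡ s → partDist t s ≡ 1 →
         (t ≡ s → u ≢ w) → Walk (AdjInd ι) u w 1
  edge eu ew t~s u≢w = step (adjacent eu ew t~s u≢w) here

  dist≤length : ∀ {u v ℓ} → Walk (AdjInd ι) u v ℓ → dist u v ≤ ℓ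
  dist≤length {u} here with u ≟ u
  ... | yes _   = z≤n
  ... | no  u≢u = ⊥-elim (u≢u refl)
  dist≤length {u} {v} (step {w = w} {ℓ = ℓ} u~w W) = begin
    dist u v                        ≤⟨ dist≤partDist u v ⟩
    partDist (partOf u) (partOf v)  ≤⟨ partDist-step (partOf u) (partOf w) (partOf v)
                                                     (adjacent⇒partDist≡1 refl refl u~w) ⟩
    suc (gap (partOf w) (partOf v)) ≤⟨ s≤s (gap≤dist w v) ⟩
    suc (dist w v)                  ≤⟨ s≤s (dist≤length W) ⟩
    suc ℓ                           ∎
    where open ℕP.≤-Reasoning

  walk-leaving-B₁⇒∃A₁ : ∀ {u v ℓ s} → Walk (AdjInd ι) u v ℓ → partOf u ≡ B₁ → partOf v ≡ s →
                        s ≢ B₁ → ∃ λ w → partOf w ≡ A₁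
  walk-leaving-B₁⇒∃A₁ here eu ev s≢B₁ = ⊥-elim (s≢B₁ (trans (sym ev) eu))
  walk-leaving-B₁⇒∃A₁ (step {w = w} u~w W) eu ev s≢B₁ with partOf w in ew
  ... | B₁ = walk-leaving-B₁⇒∃A₁ W ew ev s≢B₁
  ... | A₁ = w , ew
  ... | A₂ with () ← adjacent⇒partDist≡1 eu ew u~w
  ... | B₂ with () ← adjacent⇒partDist≡1 eu ew u~w

  walk-leaving-B₂⇒∃A₂ : ∀ {u v ℓ s} → Walk (AdjInd ι) u v ℓ → partOf u ≡ B₂ → partOf v ≡ s →
                        s ≢ B₂ → ∃ λ w → partOf w ≡ A₂
  walk-leaving-B₂⇒∃A₂ here eu ev s≢B₂ = ⊥-elim (s≢B₂ (trans (sym ev) eu))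
  walk-leaving-B₂⇒∃A₂ (step {w = w} u~w W) eu ev s≢B₂ with partOf w in ew
  ... | B₂ = walk-leaving-B₂⇒∃A₂ W ew ev s≢B₂
  ... | A₂ = w , ew
  ... | A₁ with () ← adjacent⇒partDist≡1 eu ew u~w
  ... | B₁ with () ← adjacent⇒partDist≡1 eu ew u~w

  -- Adjacency between different parts depends only on the parts, so the first step of
  -- any walk out of u is also adjacent to v.
  common-neighbour : ∀ {u v ℓ t} → Walk (AdjInd ι) u v ℓ → u ≢ v → partOf u ≡ t → partOf v ≡ t →
                     partDist t t ≡ 2 → Walk (AdjInd ι) u v 2
  common-neighbour here u≢u _ _ _ = ⊥-elim (u≢u refl)
  common-neighbour {v = v} {t = t} (step {w = w} u~w _) _ eu ev t≁t =
    step u~w (edge refl ev (trans (partDist-sym (partOf w) t) t~w) w∉t)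
    where
    t~w : partDist t (partOf w) ≡ 1
    t~w = adjacent⇒partDist≡1 eu refl u~w
    w∉t : partOf w ≡ t → w ≢ v
    w∉t w∈t _ with () ← trans (sym t≁t) (trans (cong (partDist t) (sym w∈t)) t~w)

  module _ (connected : Connected (AdjInd ι)) where

    walk : ∀ u v → Walk (AdjInd ι) u v (proj₁ (connected u v))
    walk u v = proj₂ (connected u v)

    partDist-walk : ∀ u v → u ≢ v → Walk (AdjInd ι) u v (partDist (partOf u) (partOf v))
    partDist-walk u v u≢v with partOf u in eu | partOf v in ev
    ... | B₁ | B₁ = edge eu ev refl λ _ → u≢v
    ... | B₁ | A₁ = edge eu ev refl λ ()
    ... | A₁ | B₁ = edge eu ev refl λ ()
    ... | A₁ | A₂ = edge eu ev refl λ ()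
    ... | A₂ | A₁ = edge eu ev refl λ ()
    ... | A₂ | B₂ = edge eu ev refl λ ()
    ... | B₂ | A₂ = edge eu ev refl λ ()
    ... | B₂ | B₂ = edge eu ev refl λ _ → u≢v
    ... | A₁ | A₁ = common-neighbour (walk u v) u≢v eu ev refl
    ... | A₂ | A₂ = common-neighbour (walk u v) u≢v eu ev refl
    ... | B₁ | A₂ with w , ew ← walk-leaving-B₁⇒∃A₁ (walk u v) eu ev (λ ())
      = step (adjacent eu ew refl λ ()) (edge ew ev refl λ ())
    ... | A₂ | B₁ with w , ew ← walk-leaving-B₁⇒∃A₁ (walk v u) ev eu (λ ())
      = step (adjacent eu ew refl λ ()) (edge ew ev refl λ ())
    ... | B₂ | A₁ with w , ew ← walk-leaving-B₂⇒∃A₂ (walk u v) eu ev (λ ())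
      = step (adjacent eu ew refl λ ()) (edge ew ev refl λ ())
    ... | A₁ | B₂ with w , ew ← walk-leaving-B₂⇒∃A₂ (walk v u) ev eu (λ ())
      = step (adjacent eu ew refl λ ()) (edge ew ev refl λ ())
    ... | B₁ | B₂ with w , ew ← walk-leaving-B₁⇒∃A₁ (walk u v) eu ev (λ ())
                   | w′ , ew′ ← walk-leaving-B₂⇒∃A₂ (walk v u) ev eu (λ ())
      = step (adjacent eu ew refl λ ()) (step (adjacent ew ew′ refl λ ()) (edge ew′ ev refl λ ()))
    ... | B₂ | B₁ with w , ew ← walk-leaving-B₂⇒∃A₂ (walk u v) eu ev (λ ())
                   | w′ , ew′ ← walk-leaving-B₁⇒∃A₁ (walk v u) ev eu (λ ())
      = step (adjacent eu ew refl λ ()) (step (adjacent ew ew′ refl λ ()) (edge ew′ ev refl λ ()))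

    dist-walk : ∀ u v → Walk (AdjInd ι) u v (dist u v)
    dist-walk u v with u ≟ v
    ... | yes refl = here
    ... | no  u≢v  = partDist-walk u v u≢v

    distanceMatrix≡dist : ∀ {D} → IsDistanceMatrix (AdjInd ι) D → ∀ u v → D u v ≡ dist u v
    distanceMatrix≡dist isDist u v =
      ℕP.≤-antisym (proj₂ (isDist u v) _ (dist-walk u v)) (dist≤length (proj₁ (isDist u v)))

  weight : Fin k → ℤ
  weight u = partMatrix (partOf u) (partOf u)

  eval-DX : ∀ {D} → (∀ u v → D u v ≡ dist u v) →
            ∀ u v → eval weight (DX D u v) ≡ partMatrix (partOf u) (partOf v)
  eval-DX D≡dist u v rewrite D≡dist u v with u ≟ v
  ... | yes refl = ℤP.+-identityʳ (weight u)
  ... | no  _    = refl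

  3∣minor : ∀ {D i} → (∀ u v → D u v ≡ dist u v) → 3 ≤ i →
            ∀ r c → + 3 ∣ eval weight (minor {i} (DX D) r c)
  3∣minor {D} D≡dist 3≤i (r , _) (c , _) = subst (+ 3 ∣_) (sym evaluated-minor)
    (3∣det-partMatrix 3≤i (partOf ∘ r) (partOf ∘ c))
    where
    evaluated-minor : eval weight (det (λ a b → DX D (r a) (c b)))
                    ≡ detℤ (reindex partMatrix (partOf ∘ r) (partOf ∘ c))
    evaluated-minor = trans (eval-det weight (λ a b → DX D (r a) (c b))) (detℤ-cong λ a b → eval-DX D≡dist (r a) (c b))

mainTheorem13 : (n₁ m₁ m₂ n₂ : ℕ) → 1 ≤ n₁ → 1 ≤ m₁ → 1 ≤ m₂ → 1 ≤ n₂ →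
    (k : ℕ) (ι : Fin k → VΩ n₁ m₁ m₂ n₂) → Injective _≡_ _≡_ ι →
    Connected (AdjInd ι) →
    (D : Fin k → Fin k → ℕ) → IsDistanceMatrix (AdjInd ι) D →
    InΛ 2 D
mainTheorem13 n₁ m₁ m₂ n₂ _ _ _ _ k ι ι-injective connected D isDist f f-increasing f-positive all-trivial =
  minors-divisible⇒¬TrivialIdeal (DX D) weight (f (# 2)) (from-no (+ 3 ∣? + 1))
    (3∣minor (distanceMatrix≡dist connected isDist) 3≤f₂) (all-trivial (# 2))
  where
  open InducedSubgraph ι ι-injective
  3≤f₂ : 3 ≤ f (# 2)
  3≤f₂ = ℕP.≤-trans (s≤s (ℕP.≤-trans (s≤s (f-positive (# 0))) (f-increasing (# 0) (# 1) (s≤s z≤n))))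
                    (f-increasing (# 1) (# 2) (s≤s (s≤s z≤n)))
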